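{- Let $\tau$ be a correct translation. For $k = 2$ the blocking types $(P_1P_1,P_1)$, $(P_1, P_1P_1)$, and $(P_1, P_1)$ are not possible.
   Context: SYNCSIMPLE: subprocesses $U ::= \checkmark \mid 0 \mid\ !U \mid\ ?U$; processes are parallel compositions (multisets) of subprocesses; reduction $!U_1 \mid ?U_2 \mid P \to U_1 \mid U_2 \mid P$; successful = has a parallel component $\checkmark$; may-convergent = reduces to a successful process; must-convergent = every reduct is may-convergent. LOCKSIMPLE$_{k,IS}$: $k$ locks, each full ($\blacksquare$) or empty ($\Box$), initial store $IS$; subprocesses $U ::= 0 \mid \checkmark \mid P_iU \mid T_iU$; $P_i$ on empty lock $i$ fills it, on a full lock blocks; $T_i$ never blocks and empties lock $i$. Convergence evaluated from $(P,IS)$. $\tau$ is a compositional translation SYNCSIMPLE $\to$ LOCKSIMPLE$_{2,IS}$ ($\tau(0)=0$, $\tau(\checkmark)=\checkmark$, $\tau$ commutes with parallel composition, $\tau(!U)=\tau(!)\tau(U)$, $\tau(?U)=\tau(?)\tau(U)$); correct = preserve and reflect may- and must-convergence. Blocking types: for a sequence $S$ executed alone from $IS$, a blocking prefix is either $R_1P_iR_2P_i$ with $R_2$ free of $P_i,T_i$ and execution deadlocking exactly before the last $P_i$ (type $P_iP_i$), or $R_1P_i$ with $R_1$ free of $P_i,T_i$ and execution deadlocking exactly before this $P_i$ (type $P_i$). $\tau$ has blocking type $(W_1,W_2)$ if $W_1$ is the type of $\tau(!)$ and $W_2$ that of $\tau(?)$. -}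

module Defs where

open import Data.Bool using (Bool; true; false)
open import Data.Fin using (Fin; _≟_)
open import Data.List using (List; []; _∷_; _++_; map)
open import Data.List.Membership.Propositional using (_∈_)
open import Data.List.Relation.Binary.Permutation.Propositional using (_↭_)
open import Data.List.Relation.Unary.All using (All)
open import Data.Maybe using (Maybe; just; nothing)
open import Data.Product using (Σ; ∃; _×_; _,_)
open import Relation.Nullary using (¬_; yes; no)
open import Relation.Binary.PropositionalEquality using (_≡_)
open import Relation.Binary.Construct.Closure.ReflexiveTransitive using (Star)
open import Function.Bundles using (_⇔_)

data SU : Set where
  ✓S  : SU
  0S  : SU
  !_  : SU → SU
  ¿_  : SU → SU          -- the "?" prefix

-- processes: multisets of subprocesses, represented as lists up to ↭
SProc : Set
SProc = List SU

data _⟶S_ : SProc → SProc → Set where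
  sync : ∀ {P Q} U₁ U₂ R → P ↭ (! U₁ ∷ ¿ U₂ ∷ R) → Q ↭ (U₁ ∷ U₂ ∷ R) → P ⟶S Q

_⟶S*_ : SProc → SProc → Set
_⟶S*_ = Star _⟶S_

SuccessfulS : SProc → Set
SuccessfulS P = ✓S ∈ P

MayS : SProc → Set
MayS P = ∃ λ Q → P ⟶S* Q × SuccessfulS Q

MustS : SProc → Set
MustS P = ∀ Q → P ⟶S* Q → MayS Q

K : _
K = 2

data Op : Set where
  P T : Fin K → Op

-- lock store: true = full (■), false = empty (□)
Store : Set
Store = Fin K → Bool

update : Store → Fin K → Bool → Store
update σ i b j with i ≟ j
... | yes _ = b
... | no  _ = σ j

-- one operation executed on the store; nothing = blocked
step : Store → Op → Maybe Store
step σ (P i) with σ i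
... | true  = nothing
... | false = just (update σ i true)
step σ (T i) = just (update σ i false)

run : Store → List Op → Maybe Store
run σ [] = just σ
run σ (o ∷ os) with step σ o
... | nothing = nothing
... | just σ' = run σ' os

data LU : Set where
  0L  : LU
  ✓L  : LU
  _∙_ : Op → LU → LU

LProc : Set
LProc = List LU

data _⟶L_ : LProc × Store → LProc × Store → Set where
  act : ∀ {Π Π' σ σ'} o U R → Π ↭ (o ∙ U ∷ R) → step σ o ≡ just σ' →
        Π' ↭ (U ∷ R) → (Π , σ) ⟶L (Π' , σ')

_⟶L*_ : LProc × Store → LProc × Store → Set
_⟶L*_ = Star _⟶L_

SuccessfulL : LProc × Store → Set
SuccessfulL (Π , σ) = ✓L ∈ Π

MayL : LProc × Store → Set
MayL c = ∃ λ c' → c ⟶L* c' × SuccessfulL c'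

MustL : LProc × Store → Set
MustL c = ∀ c' → c ⟶L* c' → MayL c'

-- Compositional translations, determined by the words τ(!) and τ(?)

prefix : List Op → LU → LU
prefix []       U = U
prefix (o ∷ os) U = o ∙ prefix os U

τU : (w! w? : List Op) → SU → LU
τU w! w? ✓S    = ✓L
τU w! w? 0S    = 0L
τU w! w? (! U) = prefix w! (τU w! w? U)
τU w! w? (¿ U) = prefix w? (τU w! w? U)

τ : (w! w? : List Op) → SProc → LProc
τ w! w? = map (τU w! w?)

Correct : Store → (w! w? : List Op) → Set
Correct IS w! w? = ∀ (Q : SProc) →
  (MayS Q ⇔ MayL (τ w! w? Q , IS)) × (MustS Q ⇔ MustL (τ w! w? Q , IS))

FreeOp : Fin K → Op → Set
FreeOp i (P j) = ¬ (i ≡ j)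
FreeOp i (T j) = ¬ (i ≡ j)

FreeOf : Fin K → List Op → Set
FreeOf i = All (FreeOp i)

-- "executed alone from IS, execution deadlocks exactly before the P_i
--  following the prefix pre": pre runs without blocking and lock i is then full
DeadlocksBefore : Store → List Op → Fin K → Set
DeadlocksBefore IS pre i = ∃ λ σ → run IS pre ≡ just σ × σ i ≡ true

TypePP : Store → Fin K → List Op → Set
TypePP IS i S = ∃ λ R₁ → ∃ λ R₂ → ∃ λ S' →
  S ≡ R₁ ++ P i ∷ R₂ ++ P i ∷ S' × FreeOf i R₂ ×
  DeadlocksBefore IS (R₁ ++ P i ∷ R₂) i

TypeP : Store → Fin K → List Op → Set
TypeP IS i S = ∃ λ R₁ → ∃ λ S' →
  S ≡ R₁ ++ P i ∷ S' × FreeOf i R₁ × DeadlocksBefore IS R₁ i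

-- The translation of  !0 | ?✓  (and of  !✓ | ?0) must converge, since the source process does.
-- A blocking prefix of type P₁ leaves the whole τ(!) or τ(?) waiting at a P₁ without having
-- touched lock 1, and forces lock 1 to be full initially; a blocking prefix of type P₁P₁ can be
-- executed alone up to a point where lock 1 is full and the rest of that thread again waits at
-- a P₁. In each of the three combinations some reachable configuration therefore has lock 1 full
-- and every thread waiting at a P₁ before touching lock 1. Such a configuration is jammed: no
-- thread can pass its P₁, so lock 1 stays full forever and ✓ is never exposed, contradicting
-- must-convergence.
module Submission where

open import Defs
open import Data.Bool using (true; false)
open import Data.Fin using (Fin; zero; _≟_)
open import Data.List using (List; []; _∷_; _++_)
open import Data.List.Properties using (++-assoc)
open import Data.List.Relation.Unary.Any using (here; there)
open import Data.List.Relation.Unary.All as All using (All; []; _∷_)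
open import Data.List.Relation.Unary.All.Properties using (++⁺)
open import Data.List.Relation.Binary.Permutation.Propositional using (_↭_; ↭-refl; ↭-sym)
open import Data.List.Relation.Binary.Permutation.Propositional.Properties
  using (All-resp-↭; ∈-resp-↭; ↭-length; shift)
open import Data.Maybe using (just)
open import Data.Product using (_×_; _,_; ∃; proj₂)
open import Data.Empty using (⊥-elim)
open import Relation.Nullary using (¬_; yes; no)
open import Relation.Binary.PropositionalEquality
open import Relation.Binary.Construct.Closure.ReflexiveTransitive using (ε; _◅_)
open import Function.Bundles using (Equivalence)

✓-persists : ∀ {P Q} → SuccessfulS P → P ⟶S Q → SuccessfulS Q
✓-persists s (sync U₁ U₂ R p q) with ∈-resp-↭ p s
... | here ()
... | there (here ())
... | there (there s-R) = ∈-resp-↭ (↭-sym q) (there (there s-R))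

✓-persists* : ∀ {P Q} → SuccessfulS P → P ⟶S* Q → SuccessfulS Q
✓-persists* s ε          = s
✓-persists* s (r ◅ rs) = ✓-persists* (✓-persists s r) rs

sync-pair-↭-inv : ∀ {a b U₁ U₂ R} → (! a ∷ ¿ b ∷ []) ↭ (! U₁ ∷ ¿ U₂ ∷ R) →
  a ≡ U₁ × b ≡ U₂ × R ≡ []
sync-pair-↭-inv {R = _ ∷ _} p with ↭-length p
... | ()
sync-pair-↭-inv {R = []} p with ∈-resp-↭ p (here refl) | ∈-resp-↭ p (there (here refl))
... | here refl | there (here refl) = refl , refl , refl
... | here refl | here ()
... | there (here ()) | _

sync-pair-step : ∀ {a b Q} → SuccessfulS (a ∷ b ∷ []) → (! a ∷ ¿ b ∷ []) ⟶S Q → SuccessfulS Q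
sync-pair-step s (sync U₁ U₂ R p q) with sync-pair-↭-inv p
... | refl , refl , refl = ∈-resp-↭ (↭-sym q) s

must-sync-pair : ∀ {a b} → SuccessfulS (a ∷ b ∷ []) → MustS (! a ∷ ¿ b ∷ [])
must-sync-pair {a} {b} s _ ε        = (a ∷ b ∷ []) , sync a b [] ↭-refl ↭-refl ◅ ε , s
must-sync-pair         s Q (r ◅ rs) = Q , ε , ✓-persists* (sync-pair-step s r) rs

update-≢ : ∀ σ {i j} b → ¬ (i ≡ j) → update σ j b i ≡ σ i
update-≢ σ {i} {j} b i≢j with j ≟ i
... | yes refl = ⊥-elim (i≢j refl)
... | no  _    = refl

step-free : ∀ {σ σ' i} o → FreeOp i o → step σ o ≡ just σ' → σ' i ≡ σ i
step-free {σ} (P j) i≢j eq with σ j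
step-free {σ} (P j) i≢j ()   | true
step-free {σ} (P j) i≢j refl | false = update-≢ σ true i≢j
step-free {σ} (T j) i≢j refl = update-≢ σ false i≢j

run-free : ∀ {σ σ' i} os → FreeOf i os → run σ os ≡ just σ' → σ' i ≡ σ i
run-free [] [] refl = refl
run-free {σ} (o ∷ os) (free ∷ frees) eq with step σ o in stepped
... | just σ'' = trans (run-free os frees eq) (step-free o free stepped)

step-P-full : ∀ {σ σ' i} → σ i ≡ true → ¬ (step σ (P i) ≡ just σ')
step-P-full full eq rewrite full with eq
... | ()

data WaitsOn (i : Fin K) : LU → Set where
  idle  : WaitsOn i 0L
  at-P  : ∀ U → WaitsOn i (P i ∙ U)
  later : ∀ {o U} → FreeOp i o → WaitsOn i U → WaitsOn i (o ∙ U)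

Jammed : Fin K → LProc × Store → Set
Jammed i (Π , σ) = σ i ≡ true × All (WaitsOn i) Π

jammed-⟶L : ∀ {i c c'} → c ⟶L c' → Jammed i c → Jammed i c'
jammed-⟶L (act {σ = σ} o U R p stepped p') (full , waits) with All-resp-↭ p waits
... | at-P _ ∷ _             = ⊥-elim (step-P-full {σ = σ} full stepped)
... | later free waitsU ∷ waitsR =
  trans (step-free o free stepped) full , All-resp-↭ (↭-sym p') (waitsU ∷ waitsR)

jammed-⟶L* : ∀ {i c c'} → c ⟶L* c' → Jammed i c → Jammed i c'
jammed-⟶L* ε        j = j
jammed-⟶L* (r ◅ rs) j = jammed-⟶L* rs (jammed-⟶L r j)

¬WaitsOn-✓ : ∀ {i} → ¬ WaitsOn i ✓L
¬WaitsOn-✓ ()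

jammed⇒¬MayL : ∀ {i c} → Jammed i c → ¬ MayL c
jammed⇒¬MayL j (c' , rs , success) = ¬WaitsOn-✓ (All.lookup (proj₂ (jammed-⟶L* rs j)) success)

MustL-¬jammed : ∀ {i c₀ c} → MustL c₀ → c₀ ⟶L* c → ¬ Jammed i c
MustL-¬jammed must rs j = jammed⇒¬MayL j (must _ rs)

prefix-++ : ∀ xs ys U → prefix (xs ++ ys) U ≡ prefix xs (prefix ys U)
prefix-++ []       ys U = refl
prefix-++ (o ∷ xs) ys U = cong (o ∙_) (prefix-++ xs ys U)

run⇒⟶L* : ∀ {σ σ'} os L U R → run σ os ≡ just σ' →
  (L ++ prefix os U ∷ R , σ) ⟶L* (L ++ U ∷ R , σ')
run⇒⟶L* []       L U R refl = ε
run⇒⟶L* {σ} (o ∷ os) L U R ran with step σ o in stepped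
... | just σ'' = act o (prefix os U) (L ++ R) (shift _ L R) stepped (shift _ L R)
                   ◅ run⇒⟶L* os L U R ran

typeP⇒waitsOn : ∀ {IS i w} U → TypeP IS i w → WaitsOn i (prefix w U)
typeP⇒waitsOn {i = i} U (R₁ , S' , refl , frees , _) = go R₁ frees
  where
  go : ∀ xs → FreeOf i xs → WaitsOn i (prefix (xs ++ P i ∷ S') U)
  go []       []             = at-P _
  go (o ∷ xs) (free ∷ frees) = later free (go xs frees)

typeP⇒full : ∀ {IS i w} → TypeP IS i w → IS i ≡ true
typeP⇒full (R₁ , _ , _ , frees , σ , ran , full) = trans (sym (run-free R₁ frees ran)) full

typePP⇒jammed : ∀ {IS i w L R} U → All (WaitsOn i) L → All (WaitsOn i) R → TypePP IS i w →
  ∃ λ c → (L ++ prefix w U ∷ R , IS) ⟶L* c × Jammed i c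
typePP⇒jammed {IS} {i} {L = L} {R} U waitsL waitsR (R₁ , R₂ , S' , refl , _ , σ , ran , full) =
  (L ++ P i ∙ prefix S' U ∷ R , σ) ,
  subst (λ V → (L ++ V ∷ R , IS) ⟶L* _) (sym split) (run⇒⟶L* (R₁ ++ P i ∷ R₂) L _ R ran) ,
  full , ++⁺ waitsL (at-P _ ∷ waitsR)
  where
  open ≡-Reasoning
  split : prefix (R₁ ++ P i ∷ R₂ ++ P i ∷ S') U ≡ prefix (R₁ ++ P i ∷ R₂) (P i ∙ prefix S' U)
  split = begin
    prefix (R₁ ++ P i ∷ R₂ ++ P i ∷ S') U   ≡⟨ cong (λ os → prefix os U) (sym (++-assoc R₁ (P i ∷ R₂) (P i ∷ S'))) ⟩
    prefix ((R₁ ++ P i ∷ R₂) ++ P i ∷ S') U ≡⟨ prefix-++ (R₁ ++ P i ∷ R₂) (P i ∷ S') U ⟩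
    prefix (R₁ ++ P i ∷ R₂) (P i ∙ prefix S' U) ∎

proposition5p10 : ∀ (IS : Store) (w! w? : List Op) → Correct IS w! w? →
    ¬ (TypePP IS zero w! × TypeP IS zero w?) ×
    ¬ (TypeP IS zero w! × TypePP IS zero w?) ×
    ¬ (TypeP IS zero w! × TypeP IS zero w?)
proposition5p10 IS w! w? correct = PP-P , P-PP , P-P
  where
  must : ∀ {a b} → SuccessfulS (a ∷ b ∷ []) → MustL (τ w! w? (! a ∷ ¿ b ∷ []) , IS)
  must {a} {b} s = Equivalence.to (proj₂ (correct (! a ∷ ¿ b ∷ []))) (must-sync-pair s)

  PP-P : ¬ (TypePP IS zero w! × TypeP IS zero w?)
  PP-P (pp! , p?) with typePP⇒jammed 0L [] (typeP⇒waitsOn ✓L p? ∷ []) pp!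
  ... | c , rs , j = MustL-¬jammed (must {0S} {✓S} (there (here refl))) rs j

  P-PP : ¬ (TypeP IS zero w! × TypePP IS zero w?)
  P-PP (p! , pp?) with typePP⇒jammed 0L (typeP⇒waitsOn ✓L p! ∷ []) [] pp?
  ... | c , rs , j = MustL-¬jammed (must {✓S} {0S} (here refl)) rs j

  P-P : ¬ (TypeP IS zero w! × TypeP IS zero w?)
  P-P (p! , p?) = MustL-¬jammed (must {✓S} {0S} (here refl)) ε
    (typeP⇒full p? , typeP⇒waitsOn ✓L p! ∷ typeP⇒waitsOn 0L p? ∷ [])
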